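{- Let $\mathcal{F}$ be a self-associate eventual family of subsets of a set $X$, and let $\chi:\mathcal{P}(X)\to\{0,1\}$ be its characteristic function. The following are equivalent: (1) $\chi$ is finitely additive, i.e. $\chi(S\cup T)=\chi(S)+\chi(T)$ for all disjoint $S,T\subseteq X$; (2) there are no non-measured partitions of $X$; (3) there are no non-measured partitions of $X$ into three sets; (4) $\mathcal{F}$ is a filter (hence an ultrafilter).
   Context: A family $\mathcal{F}$ of subsets of $X$ is eventual if $S\in\mathcal{F}$ and $S'\supseteq S$ imply $S'\in\mathcal{F}$. It is self-associate (self-Aso) if for every $S\subseteq X$: $S\in\mathcal{F}$ if and only if $X\setminus S\notin\mathcal{F}$. A filter is an eventual family that contains $S\cap T$ whenever it contains $S$ and $T$. A finite partition $X=X_1\cup\dots\cup X_k$ into pairwise disjoint (possibly empty) sets is called measured (with respect to $\mathcal{F}$) if some $X_i$ belongs to $\mathcal{F}$, and non-measured if no $X_i$ belongs to $\mathcal{F}$. -}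

module Defs where

open import Data.Bool using (Bool; true; false; not; _∧_; _∨_; if_then_else_)
open import Data.Nat using (ℕ; _+_)
open import Data.Fin using (Fin)
open import Data.Fin.Properties using (_≟_)
open import Data.Product using (Σ; _×_)
open import Relation.Nullary using (¬_)
open import Relation.Nullary.Decidable using (isYes)
open import Relation.Binary.PropositionalEquality using (_≡_)

Subset : Set → Set
Subset X = X → Bool

Family : Set → Set
Family X = Subset X → Bool

_∈F_ : {X : Set} → Subset X → Family X → Set
S ∈F F = F S ≡ true

_⊆_ : {X : Set} → Subset X → Subset X → Set
S ⊆ T = ∀ x → S x ≡ true → T x ≡ true

complement : {X : Set} → Subset X → Subset X
complement S x = not (S x)

_∪_ : {X : Set} → Subset X → Subset X → Subset X
(S ∪ T) x = S x ∨ T x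

_∩_ : {X : Set} → Subset X → Subset X → Subset X
(S ∩ T) x = S x ∧ T x

Disjoint : {X : Set} → Subset X → Subset X → Set
Disjoint S T = ∀ x → (S ∩ T) x ≡ false

Eventual : {X : Set} → Family X → Set
Eventual F = ∀ S S' → S ⊆ S' → S ∈F F → S' ∈F F

SelfAso : {X : Set} → Family X → Set
SelfAso F = ∀ S → (S ∈F F → ¬ (complement S ∈F F)) × (¬ (complement S ∈F F) → S ∈F F)

IsFilter : {X : Set} → Family X → Set
IsFilter F = Eventual F × (∀ S T → S ∈F F → T ∈F F → (S ∩ T) ∈F F)

χ : {X : Set} → Family X → Subset X → ℕ
χ F S = if F S then 1 else 0

FinitelyAdditive : {X : Set} → Family X → Set
FinitelyAdditive F = ∀ S T → Disjoint S T → χ F (S ∪ T) ≡ χ F S + χ F T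

-- A partition of X into k pairwise disjoint, possibly empty sets X_0,…,X_{k-1}
-- is given by the map p : X → Fin k sending each point to the index of its block.
Partition : Set → ℕ → Set
Partition X k = X → Fin k

block : {X : Set} {k : ℕ} → Partition X k → Fin k → Subset X
block p i x = isYes (p x ≟ i)

NonMeasured : {X : Set} {k : ℕ} → Family X → Partition X k → Set
NonMeasured F p = ∀ i → ¬ (block p i ∈F F)

NoNonMeasuredPartitions : {X : Set} → Family X → Set
NoNonMeasuredPartitions {X} F = ∀ k → (p : Partition X k) → ¬ NonMeasured F p

NoNonMeasuredPartitions3 : {X : Set} → Family X → Set
NoNonMeasuredPartitions3 {X} F = (p : Partition X 3) → ¬ NonMeasured F p

{-# OPTIONS --safe #-}
-- For a self-associate eventual family the only way χ can fail to be additive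
-- on disjoint S, T is S ∪ T ∈ F with S, T ∉ F; then S, T and X ∖ (S ∪ T) form a
-- non-measured partition into three sets.  Conversely additivity makes F closed
-- under intersections (split S along T), and in a filter the complements of the
-- blocks of a non-measured partition would meet in ∅ ∈ F.
module Submission where

open import Data.Bool using (true; false; not; _∧_; if_then_else_)
open import Data.Bool.Properties using (∧-conicalˡ; ∧-conicalʳ; not-involutive)
  renaming (_≟_ to _≟ᵇ_)
open import Data.Empty using (⊥-elim)
open import Data.Fin using (Fin; zero; suc)
open import Data.Fin.Properties using (_≟_)
open import Data.Nat using (ℕ; _+_)
open import Data.Product using (_×_; _,_; proj₁; proj₂)
open import Data.Sum using (_⊎_; inj₁; inj₂; [_,_]′)
open import Function using (id; _∘_)
open import Function.Bundles using (_⇔_; mk⇔)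
open import Relation.Nullary using (¬_; Dec; yes; no)
open import Relation.Nullary.Decidable using (isYes≗does; dec-true)
open import Relation.Binary.PropositionalEquality using (_≡_; refl; sym; trans; cong₂; subst)

open import Defs

module _ {X : Set} where

  ∅ : Subset X
  ∅ _ = false

  full : Subset X
  full _ = true

  ⊆-full : (S : Subset X) → S ⊆ full
  ⊆-full S _ _ = refl

  ⊆-∪ˡ : (S T : Subset X) → S ⊆ (S ∪ T)
  ⊆-∪ˡ S T x Sx rewrite Sx = refl

  ⊆-∪ʳ : (S T : Subset X) → T ⊆ (S ∪ T)
  ⊆-∪ʳ S T x Tx with S x
  ... | true  = refl
  ... | false = Tx

  ∩-⊆ʳ : (S T : Subset X) → (S ∩ T) ⊆ T
  ∩-⊆ʳ S T x = ∧-conicalʳ (S x) (T x)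

  complement-involutive-⊆ : (S : Subset X) → complement (complement S) ⊆ S
  complement-involutive-⊆ S x = subst (_≡ true) (not-involutive (S x))

  disjoint⇒⊆-complement : {S T : Subset X} → Disjoint S T → S ⊆ complement T
  disjoint⇒⊆-complement {S} {T} d x Sx with T x | d x
  ... | false | _ = refl
  ... | true  | Sx∧true≡false = sym (subst (λ b → b ∧ true ≡ false) Sx Sx∧true≡false)

  ⊆-∩-∪-∩-complement : (S T : Subset X) → S ⊆ ((S ∩ T) ∪ (S ∩ complement T))
  ⊆-∩-∪-∩-complement S T x Sx rewrite Sx with T x
  ... | true  = refl
  ... | false = refl

  ∩-disjoint-∩-complement : (S T : Subset X) → Disjoint (S ∩ T) (S ∩ complement T)
  ∩-disjoint-∩-complement S T x with S x | T x
  ... | true  | true  = refl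
  ... | true  | false = refl
  ... | false | _     = refl

  ⋂ : {n : ℕ} → (Fin n → Subset X) → Subset X
  ⋂ {ℕ.zero}  B _ = true
  ⋂ {ℕ.suc n} B x = B zero x ∧ ⋂ (B ∘ suc) x

  ⋂-⊆ : {n : ℕ} (B : Fin n → Subset X) (i : Fin n) → ⋂ B ⊆ B i
  ⋂-⊆ B zero    x = ∧-conicalˡ (B zero x) _
  ⋂-⊆ B (suc i) x = ⋂-⊆ (B ∘ suc) i x ∘ ∧-conicalʳ (B zero x) _

  ∈-own-block : {k : ℕ} (p : Partition X k) (x : X) → block p (p x) x ≡ true
  ∈-own-block p x = trans (isYes≗does (p x ≟ p x)) (dec-true (p x ≟ p x) refl)

  split₃ : Subset X → Subset X → Partition X 3
  split₃ S T x = if S x then zero else if T x then suc zero else suc (suc zero)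

  block-split₃-⊆ : (S T : Subset X) →
    (block (split₃ S T) zero ⊆ S) × (block (split₃ S T) (suc zero) ⊆ T)
    × (block (split₃ S T) (suc (suc zero)) ⊆ complement (S ∪ T))
  block-split₃-⊆ S T = first , second , third
    where
    first : block (split₃ S T) zero ⊆ S
    first x h with S x | T x
    first x h  | true  | _     = refl
    first x () | false | true
    first x () | false | false

    second : block (split₃ S T) (suc zero) ⊆ T
    second x h with S x | T x
    second x () | true  | _
    second x h  | false | true  = refl
    second x () | false | false

    third : block (split₃ S T) (suc (suc zero)) ⊆ complement (S ∪ T)
    third x h with S x | T x
    third x () | true  | _
    third x () | false | true
    third x h  | false | false = refl

_∈F?_ : {X : Set} (S : Subset X) (F : Family X) → Dec (S ∈F F)
S ∈F? F = F S ≟ᵇ true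

module _ {X : Set} (F : Family X) where

  χ-∈ : {S : Subset X} → S ∈F F → χ F S ≡ 1
  χ-∈ S∈F rewrite S∈F = refl

  χ-∉ : {S : Subset X} → ¬ S ∈F F → χ F S ≡ 0
  χ-∉ {S} S∉F with F S
  ... | true  = ⊥-elim (S∉F refl)
  ... | false = refl

  Prime : Set
  Prime = ∀ S T → Disjoint S T → (S ∪ T) ∈F F → S ∈F F ⊎ T ∈F F

module _ {X : Set} {F : Family X} (ev : Eventual F) where

  ∉-⊆ : {S T : Subset X} → S ⊆ T → ¬ T ∈F F → ¬ S ∈F F
  ∉-⊆ S⊆T T∉F = T∉F ∘ ev _ _ S⊆T

  filter-⋂ : IsFilter F → full ∈F F →
    {n : ℕ} (B : Fin n → Subset X) → (∀ i → B i ∈F F) → ⋂ B ∈F F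
  filter-⋂ _ full∈F {ℕ.zero}  B _   = full∈F
  filter-⋂ filter full∈F {ℕ.suc n} B B∈F =
    proj₂ filter _ _ (B∈F zero) (filter-⋂ filter full∈F (B ∘ suc) (B∈F ∘ suc))

  module _ (sa : SelfAso F) where

    complement-∉ : {S : Subset X} → S ∈F F → ¬ complement S ∈F F
    complement-∉ {S} = proj₁ (sa S)

    complement-∈ : {S : Subset X} → ¬ S ∈F F → complement S ∈F F
    complement-∈ {S} S∉F =
      proj₂ (sa (complement S)) (∉-⊆ (complement-involutive-⊆ S) S∉F)

    ∅-∉ : ¬ ∅ ∈F F
    ∅-∉ ∅∈F = complement-∉ ∅∈F (ev _ _ (⊆-full _) ∅∈F)

    full-∈ : full ∈F F
    full-∈ = complement-∈ ∅-∉

    disjoint-∉ : {S T : Subset X} → Disjoint S T → S ∈F F → ¬ T ∈F F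
    disjoint-∉ d S∈F T∈F = complement-∉ T∈F (ev _ _ (disjoint⇒⊆-complement d) S∈F)

    additive⇒prime : FinitelyAdditive F → Prime F
    additive⇒prime additive S T d S∪T∈F with S ∈F? F | T ∈F? F
    ... | yes S∈F | _       = inj₁ S∈F
    ... | no _    | yes T∈F = inj₂ T∈F
    ... | no S∉F  | no T∉F  with () ←
      trans (sym (χ-∈ F S∪T∈F))
            (trans (additive S T d) (cong₂ _+_ (χ-∉ F S∉F) (χ-∉ F T∉F)))

    prime⇒additive : Prime F → FinitelyAdditive F
    prime⇒additive prime S T d with S ∈F? F | T ∈F? F
    ... | yes S∈F | yes T∈F = ⊥-elim (disjoint-∉ d S∈F T∈F)
    ... | yes S∈F | no T∉F  =
      trans (χ-∈ F (ev _ _ (⊆-∪ˡ S T) S∈F)) (sym (cong₂ _+_ (χ-∈ F S∈F) (χ-∉ F T∉F)))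
    ... | no S∉F  | yes T∈F =
      trans (χ-∈ F (ev _ _ (⊆-∪ʳ S T) T∈F)) (sym (cong₂ _+_ (χ-∉ F S∉F) (χ-∈ F T∈F)))
    ... | no S∉F  | no T∉F  =
      trans (χ-∉ F ([ S∉F , T∉F ]′ ∘ prime S T d)) (sym (cong₂ _+_ (χ-∉ F S∉F) (χ-∉ F T∉F)))

    prime⇒filter : Prime F → IsFilter F
    prime⇒filter prime = ev , closed-∩
      where
      closed-∩ : ∀ S T → S ∈F F → T ∈F F → (S ∩ T) ∈F F
      closed-∩ S T S∈F T∈F =
        [ id , (λ S∖T∈F → ⊥-elim (complement-∉ T∈F (ev _ _ (∩-⊆ʳ S _) S∖T∈F))) ]′
          (prime _ _ (∩-disjoint-∩-complement S T) (ev _ _ (⊆-∩-∪-∩-complement S T) S∈F))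

    filter⇒measured : IsFilter F → NoNonMeasuredPartitions F
    filter⇒measured filter k p nonMeasured = ∅-∉ (ev _ _ ⋂-⊆-∅ ⋂-∈F)
      where
      co-blocks : Fin k → Subset X
      co-blocks = complement ∘ block p

      ⋂-∈F : ⋂ co-blocks ∈F F
      ⋂-∈F = filter-⋂ filter full-∈ co-blocks (complement-∈ ∘ nonMeasured)

      ⋂-⊆-∅ : ⋂ co-blocks ⊆ ∅
      ⋂-⊆-∅ x h = subst (λ b → not b ≡ true) (∈-own-block p x) (⋂-⊆ co-blocks (p x) x h)

    measured₃⇒prime : NoNonMeasuredPartitions3 F → Prime F
    measured₃⇒prime measured S T d S∪T∈F with S ∈F? F | T ∈F? F
    ... | yes S∈F | _       = inj₁ S∈F
    ... | no _    | yes T∈F = inj₂ T∈F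
    ... | no S∉F  | no T∉F  = ⊥-elim (measured (split₃ S T) nonMeasured)
      where
      nonMeasured : NonMeasured F (split₃ S T)
      nonMeasured zero             = ∉-⊆ (proj₁ (block-split₃-⊆ S T)) S∉F
      nonMeasured (suc zero)       = ∉-⊆ (proj₁ (proj₂ (block-split₃-⊆ S T))) T∉F
      nonMeasured (suc (suc zero)) =
        ∉-⊆ (proj₂ (proj₂ (block-split₃-⊆ S T))) (complement-∉ S∪T∈F)

mainTheorem6 : (X : Set) (F : Family X) → Eventual F → SelfAso F →
    (FinitelyAdditive F ⇔ NoNonMeasuredPartitions F)
    × (FinitelyAdditive F ⇔ NoNonMeasuredPartitions3 F)
    × (FinitelyAdditive F ⇔ IsFilter F)
mainTheorem6 X F ev sa =
  mk⇔ (filter⇒measured ev sa ∘ additive⇒filter) (measured₃⇒additive ∘ (λ h → h 3))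
  , mk⇔ ((λ h → h 3) ∘ filter⇒measured ev sa ∘ additive⇒filter) measured₃⇒additive
  , mk⇔ additive⇒filter (measured₃⇒additive ∘ (λ h → h 3) ∘ filter⇒measured ev sa)
  where
  additive⇒filter : FinitelyAdditive F → IsFilter F
  additive⇒filter = prime⇒filter ev sa ∘ additive⇒prime ev sa

  measured₃⇒additive : NoNonMeasuredPartitions3 F → FinitelyAdditive F
  measured₃⇒additive = prime⇒additive ev sa ∘ measured₃⇒prime ev sa
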